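{- There exists $n_0$ such that the following holds for all $n \ge n_0$. Let $H$ be a graph on $n$ vertices with no isolated vertices and $\Delta(H) \le \sqrt{n}/200$, and let $\delta = \delta(H)$ be its minimum degree. Let $G=(V,E)$ be a graph on $n$ vertices with exactly $n-\delta-1$ edges, and write $V=\{v_1,\dots,v_n\}$ with $d(v_i) \ge d(v_{i+1})$ for $i=1,\dots,n-1$. Let $S_1 \subseteq V \setminus N[v_1]$ be an independent set of $G$ all of whose vertices have degree smaller than $2\sqrt{n}$, of maximum possible cardinality subject to these restrictions. Then: 1. $d(v_1) \le n-\delta-1$, $d(v_2) \le n/2$, and $d(v_i) < 2n/i$ for all $i$. 2. $|S_1| \ge \delta$; moreover, for any subset $B_1 \subseteq S_1$ with $|B_1| = \delta$, if for $i=2,\dots,n$ we let $S_i \subseteq V \setminus (N[v_i] \cup N[B_1])$ be an independent set of $G$ all of whose vertices $u$ satisfy $d(u) \le 10$, of maximum possible cardinality subject to these restrictions, then $|S_i| \ge n/18$ for all $i = 2,\dots,n$.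
   Context: $d(v)$ denotes the degree of $v$ in $G$, $N(v)$ the set of neighbors of $v$ in $G$, and for a set $W$ of vertices $N[W] = W \cup \bigcup_{w\in W} N(w)$; $N[v] = N[\{v\}]$. $\Delta(H)$ and $\delta(H)$ are the maximum and minimum degree of $H$. -}

module Defs where

open import Data.Nat using (ℕ; zero; suc; _+_; _*_; _∸_; _^_; _≤_; _<_; _⊓_; _⊔_; _<ᵇ_)
open import Data.Bool using (Bool; true; false; _∧_; if_then_else_)
open import Data.Fin using (Fin; toℕ)
open import Data.Fin.Subset using (Subset; _∈_; _∉_; _∪_; ⋃; ⁅_⁆; ∣_∣; ⊥)
open import Data.Vec using (tabulate; lookup; foldr₁)
open import Data.List using (List; map; allFin)
open import Data.Nat.ListAction using (sum)
open import Relation.Binary.PropositionalEquality using (_≡_)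

record Graph (n : ℕ) : Set where
  field
    adj    : Fin n → Fin n → Bool
    sym    : ∀ i j → adj i j ≡ adj j i
    irrefl : ∀ i → adj i i ≡ false

module _ {n : ℕ} (G : Graph n) where
  open Graph G

  nbhd : Fin n → Subset n
  nbhd v = tabulate (λ j → adj v j)

  deg : Fin n → ℕ
  deg v = ∣ nbhd v ∣

  closedNbhd : Fin n → Subset n
  closedNbhd v = ⁅ v ⁆ ∪ nbhd v

  closedNbhdSet : Subset n → Subset n
  closedNbhdSet W = W ∪ ⋃ (map (λ w → if lookup W w then nbhd w else ⊥) (allFin n))

  edgeCount : ℕ
  edgeCount = sum (map (λ i → ∣ tabulate (λ j → adj i j ∧ (toℕ i <ᵇ toℕ j)) ∣) (allFin n))

  Independent : Subset n → Set
  Independent S = ∀ u v → u ∈ S → v ∈ S → adj u v ≡ false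

  NoIsolated : Set
  NoIsolated = ∀ v → 1 ≤ deg v

minDegree : {m : ℕ} → Graph (suc m) → ℕ
minDegree G = foldr₁ _⊓_ (tabulate (deg G))

maxDegree : {m : ℕ} → Graph (suc m) → ℕ
maxDegree G = foldr₁ _⊔_ (tabulate (deg G))

-- The proof is double counting over the vertex set Fin n: vertex sets are Boolean predicates,
-- and sums are the finite sums ∑[ i < n ] of the standard library.
-- * Counting around vertices of G: the handshake lemma ∑ d = 2e; |V ∖ N[v]| = n − d(v) − 1;
--   the degrees outside N[v] plus 2 d(v) are at most 2e; and d(v) + d(w) ≤ e + 1 for v ≠ w.
--   Part 1 follows: d(v₁) ≤ e, 2 d(v₂) ≤ e + 1 ≤ n, and (i + 1) d(vᵢ) ≤ ∑ d = 2e < 2n.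
-- * A Caro–Wei-type greedy lemma: if (d + 1)(c ∸ d) ≤ K for all d, then every vertex set W
--   contains an independent set I of vertices of degree below c with c |W| ≤ ∑_W d + K |I|.
-- * Part 2: for W = V ∖ N[v₁] and (c, K) = (2, 2) the greedy set has at least n − e − 1 = δ
--   elements, and S₁ is at least as large by maximality.  For W = V ∖ (N[vᵢ] ∪ N[B₁]) and
--   (c, K) = (5, 9) it has at least n/18 elements, because d(vᵢ) ≤ n/2 and |N[B₁]| < n/5
--   (the δ vertices of B₁ have degree below 2√n, and δ ≤ √n/200).
-- The bounds hold for every n ≥ 1, so n₀ = 0.

module Submission where

open import Defs
open import Data.Nat using (ℕ; zero; suc; _+_; _*_; _∸_; _^_; _≤_; _<_)
open import Data.Fin using (Fin; toℕ; inject₁)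
open import Data.Fin.Subset using (Subset; _∈_; _∉_; _⊆_; ∣_∣)
open import Data.Product using (Σ; _×_; _,_)
open import Function.Definitions using (Injective)
open import Relation.Binary.PropositionalEquality using (_≡_)

open import Data.Nat using (z≤n; s≤s; s≤s⁻¹; >-nonZero; _<ᵇ_; _⊓_; _⊔_)
open import Data.Nat.Properties hiding (_≟_; suc-injective)
open import Data.Nat.Induction using (<-wellFounded)
open import Data.Nat.Tactic.RingSolver using (solve-∀)
open import Data.Nat.ListAction using (sum)
open import Data.Bool using (Bool; true; false; _∧_; _∨_; not; if_then_else_)
open import Data.Bool.Properties using (∧-conicalˡ; ∧-conicalʳ)
open import Data.Fin using (inject≤; fromℕ<)
open import Data.Fin.Properties using (_≟_; suc-injective; toℕ-fromℕ<; toℕ-injective; toℕ-inject≤; toℕ<n)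
open import Data.Fin.Subset using (⁅_⁆; _∪_; ⋃; ⊥)
open import Data.Fin.Subset.Properties using (∣⊥∣≡0; ∣p∣≤∣x∷p∣)
open import Data.Vec using (Vec; []; _∷_; lookup; tabulate; foldr₁)
open import Data.Vec.Properties using (lookup∘tabulate; lookup-zipWith; lookup-replicate; []=⇒lookup; lookup⇒[]=)
import Data.List as List
open import Data.List.Properties using (map-tabulate; map-∘)
open import Algebra.Properties.Semiring.Sum +-*-semiring
  using (sum-syntax; ∑-distrib-+; ∑-comm; *-distribˡ-sum; *-distribʳ-sum)
  renaming (sum-cong-≗ to ∑-cong)
open import Data.Product using (proj₁; proj₂)
open import Data.Sum using (_⊎_; inj₁; inj₂)
open import Function using (_∘_)
open import Induction.WellFounded using (Acc; acc)
open import Relation.Binary.PropositionalEquality using (refl; sym; trans; cong; cong₂; subst; _≢_; module ≡-Reasoning)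
open import Relation.Nullary using (does; yes; no; contradiction)
open import Relation.Nullary.Reflects using (ofʸ; ofⁿ)

𝟙 : Bool → ℕ
𝟙 true  = 1
𝟙 false = 0

𝟙≤1 : ∀ b → 𝟙 b ≤ 1
𝟙≤1 true  = ≤-refl
𝟙≤1 false = z≤n

∑-mono : ∀ {n} {f g : Fin n → ℕ} → (∀ i → f i ≤ g i) → ∑[ i < n ] f i ≤ ∑[ i < n ] g i
∑-mono {zero}  f≤g = z≤n
∑-mono {suc n} f≤g = +-mono-≤ (f≤g Fin.zero) (∑-mono (f≤g ∘ Fin.suc))

∑-const : ∀ n c → ∑[ i < n ] c ≡ n * c
∑-const zero    c = refl
∑-const (suc n) c = cong (c +_) (∑-const n c)

∑-zero : ∀ n → ∑[ i < n ] 0 ≡ 0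
∑-zero n = trans (∑-const n 0) (*-zeroʳ n)

𝟙[_≡_] : ∀ {n} → Fin n → Fin n → ℕ
𝟙[ v ≡ u ] = 𝟙 (does (v ≟ u))

∑-point : ∀ {n} (v : Fin n) (f : Fin n → ℕ) → ∑[ x < n ] (𝟙[ v ≡ x ] * f x) ≡ f v
∑-point {suc n} Fin.zero    f = trans (cong (f Fin.zero + 0 +_) (∑-zero n)) (trans (+-identityʳ _) (+-identityʳ _))
∑-point {suc n} (Fin.suc v) f = ∑-point v (f ∘ Fin.suc)

∑-indicator : ∀ {n} (v : Fin n) → ∑[ x < n ] 𝟙[ v ≡ x ] ≡ 1
∑-indicator v = trans (∑-cong (λ x → sym (*-identityʳ (𝟙[ v ≡ x ])))) (∑-point v (λ _ → 1))

sum-tabulate : ∀ {n} (f : Fin n → ℕ) → sum (List.tabulate f) ≡ ∑[ i < n ] f i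
sum-tabulate {zero}  f = refl
sum-tabulate {suc n} f = cong (f Fin.zero +_) (sum-tabulate (f ∘ Fin.suc))

sum-allFin : ∀ {n} (f : Fin n → ℕ) → sum (List.map f (List.allFin n)) ≡ ∑[ i < n ] f i
sum-allFin f = trans (cong sum (map-tabulate (λ i → i) f)) (sum-tabulate f)

point-multiplicity : ∀ {a n} (τ : Fin a → Fin n) → Injective _≡_ _≡_ τ →
                     ∀ u → ∑[ k < a ] 𝟙[ τ k ≡ u ] ≤ 1
point-multiplicity {zero}  τ τ-inj u = z≤n
point-multiplicity {suc a} τ τ-inj u with τ Fin.zero ≟ u
... | yes refl = s≤s (≤-trans (∑-mono missed) (≤-reflexive (∑-zero a)))
  where
  missed : ∀ k → 𝟙[ τ (Fin.suc k) ≡ τ Fin.zero ] ≤ 0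
  missed k with τ (Fin.suc k) ≟ τ Fin.zero
  ... | yes τk≡τ0 = contradiction (τ-inj τk≡τ0) λ ()
  ... | no _      = z≤n
... | no _ = point-multiplicity (τ ∘ Fin.suc) (suc-injective ∘ τ-inj) u

∑-injective : ∀ {a n} (τ : Fin a → Fin n) → Injective _≡_ _≡_ τ →
              (f : Fin n → ℕ) → ∑[ k < a ] f (τ k) ≤ ∑[ u < n ] f u
∑-injective {a} {n} τ τ-inj f = begin
  ∑[ k < a ] f (τ k)                                  ≡⟨ ∑-cong (λ k → ∑-point (τ k) f) ⟨
  ∑[ k < a ] ∑[ u < n ] (𝟙[ τ k ≡ u ] * f u)    ≡⟨ ∑-comm (λ k u → 𝟙[ τ k ≡ u ] * f u) ⟩
  ∑[ u < n ] ∑[ k < a ] (𝟙[ τ k ≡ u ] * f u)    ≡⟨ ∑-cong (λ u → *-distribʳ-sum (f u) (λ k → 𝟙[ τ k ≡ u ])) ⟨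
  ∑[ u < n ] (∑[ k < a ] 𝟙[ τ k ≡ u ] * f u)    ≤⟨ ∑-mono (λ u → *-monoˡ-≤ (f u) (point-multiplicity τ τ-inj u)) ⟩
  ∑[ u < n ] (1 * f u)                                ≡⟨ ∑-cong (λ u → *-identityˡ (f u)) ⟩
  ∑[ u < n ] f u                                      ∎
  where open ≤-Reasoning

# : ∀ {n} → (Fin n → Bool) → ℕ
# {n} W = ∑[ u < n ] 𝟙 (W u)

sumOver : ∀ {n} → (Fin n → Bool) → (Fin n → ℕ) → ℕ
sumOver {n} W f = ∑[ u < n ] (𝟙 (W u) * f u)

syntax sumOver W (λ u → e) = ∑[ u ∈ W ] e

_∖_ : ∀ {n} → (Fin n → Bool) → (Fin n → Bool) → Fin n → Bool
(W ∖ Z) u = W u ∧ not (Z u)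

#-∖ : ∀ {n} (W Z : Fin n → Bool) → # W ≤ # (W ∖ Z) + # Z
#-∖ W Z = ≤-trans (∑-mono (λ u → split (W u) (Z u))) (≤-reflexive (∑-distrib-+ (𝟙 ∘ (W ∖ Z)) (𝟙 ∘ Z)))
  where
  split : ∀ a b → 𝟙 a ≤ 𝟙 (a ∧ not b) + 𝟙 b
  split true  true  = ≤-refl
  split true  false = ≤-refl
  split false _     = z≤n

∑-∖ : ∀ {n} (W Z : Fin n → Bool) (f : Fin n → ℕ) → ∑[ u ∈ W ∖ Z ] f u ≤ ∑[ u ∈ W ] f u
∑-∖ W Z f = ∑-mono (λ u → *-monoˡ-≤ (f u) (𝟙-∧ (W u) (not (Z u))))
  where
  𝟙-∧ : ∀ a b → 𝟙 (a ∧ b) ≤ 𝟙 a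
  𝟙-∧ true  b = 𝟙≤1 b
  𝟙-∧ false _ = z≤n

∣p∣≡# : ∀ {n} (p : Subset n) → ∣ p ∣ ≡ # (lookup p)
∣p∣≡# []          = refl
∣p∣≡# (true ∷ p)  = cong suc (∣p∣≡# p)
∣p∣≡# (false ∷ p) = ∣p∣≡# p

∣tabulate∣≡# : ∀ {n} (W : Fin n → Bool) → ∣ tabulate W ∣ ≡ # W
∣tabulate∣≡# W = trans (∣p∣≡# (tabulate W)) (∑-cong (λ u → cong 𝟙 (lookup∘tabulate W u)))

∈-tabulate : ∀ {n} (W : Fin n → Bool) u → u ∈ tabulate W → W u ≡ true
∈-tabulate W u u∈ = trans (sym (lookup∘tabulate W u)) ([]=⇒lookup u∈)

lookup-⁅⁆ : ∀ {n} (v u : Fin n) → lookup ⁅ v ⁆ u ≡ does (v ≟ u)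
lookup-⁅⁆ Fin.zero    Fin.zero    = refl
lookup-⁅⁆ Fin.zero    (Fin.suc u) = lookup-replicate u false
lookup-⁅⁆ (Fin.suc v) Fin.zero    = refl
lookup-⁅⁆ (Fin.suc v) (Fin.suc u) = lookup-⁅⁆ v u

not-true : ∀ {b} → not b ≡ true → b ≡ false
not-true {false} _ = refl

∉-lookup : ∀ {n} (p : Subset n) u → lookup p u ≡ false → u ∉ p
∉-lookup p u p[u]≡false u∈p with trans (sym ([]=⇒lookup u∈p)) p[u]≡false
... | ()

∣p∪q∣≤∣p∣+∣q∣ : ∀ {n} (p q : Subset n) → ∣ p ∪ q ∣ ≤ ∣ p ∣ + ∣ q ∣
∣p∪q∣≤∣p∣+∣q∣ []          []          = z≤n
∣p∪q∣≤∣p∣+∣q∣ (true ∷ p)  (x ∷ q)     = s≤s (≤-trans (∣p∪q∣≤∣p∣+∣q∣ p q) (+-monoʳ-≤ ∣ p ∣ (∣p∣≤∣x∷p∣ x q)))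
∣p∪q∣≤∣p∣+∣q∣ (false ∷ p) (true ∷ q)  = ≤-trans (s≤s (∣p∪q∣≤∣p∣+∣q∣ p q)) (≤-reflexive (sym (+-suc ∣ p ∣ ∣ q ∣)))
∣p∪q∣≤∣p∣+∣q∣ (false ∷ p) (false ∷ q) = ∣p∪q∣≤∣p∣+∣q∣ p q

∣⋃∣≤sum : ∀ {n} (ps : List.List (Subset n)) → ∣ ⋃ ps ∣ ≤ sum (List.map ∣_∣ ps)
∣⋃∣≤sum {n} List.[]       = ≤-reflexive (∣⊥∣≡0 n)
∣⋃∣≤sum     (p List.∷ ps) = ≤-trans (∣p∪q∣≤∣p∣+∣q∣ p (⋃ ps)) (+-monoʳ-≤ ∣ p ∣ (∣⋃∣≤sum ps))

antitone : ∀ {m} (D : Fin (suc m) → ℕ) → (∀ (i : Fin m) → D (Fin.suc i) ≤ D (inject₁ i)) →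
           ∀ a b → toℕ a ≤ toℕ b → D b ≤ D a
antitone         D step Fin.zero    Fin.zero    _         = ≤-refl
antitone {suc m} D step Fin.zero    (Fin.suc b) _         =
  ≤-trans (antitone (D ∘ Fin.suc) (step ∘ Fin.suc) Fin.zero b z≤n) (step Fin.zero)
antitone {suc m} D step (Fin.suc a) (Fin.suc b) (s≤s a≤b) = antitone (D ∘ Fin.suc) (step ∘ Fin.suc) a b a≤b

-- If f decreases along an injective enumeration σ, the (i+1)-th value is at most a (i+1)-th of the total:
-- the i+1 values f(σ 0), …, f(σ i) are all at least f(σ i).
sorted-value-bound : ∀ {m n} (σ : Fin (suc m) → Fin n) → Injective _≡_ _≡_ σ → (f : Fin n → ℕ) →
                     (∀ (i : Fin m) → f (σ (Fin.suc i)) ≤ f (σ (inject₁ i))) →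
                     ∀ i → (toℕ i + 1) * f (σ i) ≤ ∑[ u < n ] f u
sorted-value-bound {m} {n} σ σ-inj f sorted i = begin
  (toℕ i + 1) * f (σ i)                   ≡⟨ cong (_* f (σ i)) (+-comm (toℕ i) 1) ⟩
  suc (toℕ i) * f (σ i)                   ≡⟨ ∑-const (suc (toℕ i)) (f (σ i)) ⟨
  ∑[ j < suc (toℕ i) ] f (σ i)            ≤⟨ ∑-mono (λ j → antitone (f ∘ σ) sorted (prefix j) i (prefix≤i j)) ⟩
  ∑[ j < suc (toℕ i) ] f (σ (prefix j))   ≤⟨ ∑-injective (σ ∘ prefix) (prefix-injective ∘ σ-inj) f ⟩
  ∑[ u < n ] f u                          ∎
  where
  open ≤-Reasoning
  prefix : Fin (suc (toℕ i)) → Fin (suc m)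
  prefix j = inject≤ j (toℕ<n i)
  prefix≤i : ∀ j → toℕ (prefix j) ≤ toℕ i
  prefix≤i j = ≤-trans (≤-reflexive (toℕ-inject≤ j (toℕ<n i))) (s≤s⁻¹ (toℕ<n j))
  prefix-injective : Injective _≡_ _≡_ prefix
  prefix-injective {j} {k} eq =
    toℕ-injective (trans (sym (toℕ-inject≤ j (toℕ<n i))) (trans (cong toℕ eq) (toℕ-inject≤ k (toℕ<n i))))

minimiser : ∀ {n} (W : Fin n → Bool) (f : Fin n → ℕ) →
            (∀ u → W u ≡ false) ⊎ Σ (Fin n) (λ v → W v ≡ true × (∀ u → W u ≡ true → f v ≤ f u))
minimiser {zero}  W f = inj₁ λ ()
minimiser {suc n} W f with minimiser (W ∘ Fin.suc) (f ∘ Fin.suc) | W Fin.zero in W0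
... | inj₁ rest-empty | false = inj₁ λ { Fin.zero → W0 ; (Fin.suc u) → rest-empty u }
... | inj₁ rest-empty | true  = inj₂ (Fin.zero , W0 , λ
        { Fin.zero    _   → ≤-refl
        ; (Fin.suc u) u∈W → contradiction (trans (sym u∈W) (rest-empty u)) λ () })
... | inj₂ (v , v∈W , v-min) | false = inj₂ (Fin.suc v , v∈W , λ
        { Fin.zero    0∈W → contradiction (trans (sym 0∈W) W0) λ ()
        ; (Fin.suc u) u∈W → v-min u u∈W })
... | inj₂ (v , v∈W , v-min) | true with f Fin.zero ≤? f (Fin.suc v)
...   | yes f0≤fv = inj₂ (Fin.zero , W0 , λ
          { Fin.zero    _   → ≤-refl
          ; (Fin.suc u) u∈W → ≤-trans f0≤fv (v-min u u∈W) })
...   | no f0≰fv  = inj₂ (Fin.suc v , v∈W , λ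
          { Fin.zero    _   → <⇒≤ (≰⇒> f0≰fv)
          ; (Fin.suc u) u∈W → v-min u u∈W })

^2-reflects-< : ∀ x y → x ^ 2 < y ^ 2 → x < y
^2-reflects-< x y x²<y² with x <? y
... | yes x<y = x<y
... | no  x≮y = contradiction x²<y² (≤⇒≯ (^-monoˡ-≤ 2 (≮⇒≥ x≮y)))

product-bound : ∀ δ d n → (200 * δ) ^ 2 ≤ n → d ^ 2 < 4 * n → 100 * δ * d < n
product-bound δ d zero    _  ()
product-bound δ d n@(suc _) hδ hd =
  *-cancelˡ-< 2 (100 * δ * d) n (^2-reflects-< (2 * (100 * δ * d)) (2 * n) (begin-strict
    (2 * (100 * δ * d)) ^ 2    ≡⟨ factor δ d ⟩
    (200 * δ) ^ 2 * d ^ 2      ≤⟨ *-monoˡ-≤ (d ^ 2) hδ ⟩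
    n * d ^ 2                  <⟨ *-monoʳ-< n hd ⟩
    n * (4 * n)                ≡⟨ square n ⟩
    (2 * n) ^ 2                ∎))
  where
  open ≤-Reasoning
  -- x ^ 2 unfolds to x * (x * 1), which the ring solver handles
  factor : ∀ δ d → 2 * (100 * δ * d) * (2 * (100 * δ * d) * 1) ≡ 200 * δ * (200 * δ * 1) * (d * (d * 1))
  factor = solve-∀
  square : ∀ n → n * (4 * n) ≡ 2 * n * (2 * n * 1)
  square = solve-∀

weight-bound₂ : ∀ d → suc d * (2 ∸ d) ≤ 2
weight-bound₂ 0                 = ≤-refl
weight-bound₂ 1                 = ≤-refl
weight-bound₂ (suc (suc d)) rewrite 0∸n≡0 d | *-zeroʳ d = z≤n

weight-bound₅ : ∀ d → suc d * (5 ∸ d) ≤ 9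
weight-bound₅ 0 = m≤m+n 5 4
weight-bound₅ 1 = m≤m+n 8 1
weight-bound₅ 2 = ≤-refl
weight-bound₅ 3 = m≤m+n 8 1
weight-bound₅ 4 = m≤m+n 5 4
weight-bound₅ (suc (suc (suc (suc (suc d))))) rewrite 0∸n≡0 d | *-zeroʳ d = z≤n

≤-square : ∀ x → x ≤ x ^ 2
≤-square zero        = z≤n
≤-square x@(suc _) = ≤-trans (≤-reflexive (sym (*-identityʳ x))) (*-monoʳ-≤ x (s≤s z≤n))

eighteen : ∀ n e d z c → 5 * n ≤ 2 * e + 3 * d + 5 * z + 9 * c + 5 →
           e + 1 ≤ n → 2 * d ≤ n → 10 * z + 6 ≤ 2 * n → n ≤ 18 * c
eighteen n e d z c count e<n 2d≤n z-small = +-cancelˡ-≤ (9 * n) n (18 * c) (begin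
  9 * n + n                                          ≡⟨ double n ⟩
  2 * (5 * n)                                        ≤⟨ *-monoʳ-≤ 2 count ⟩
  2 * (2 * e + 3 * d + 5 * z + 9 * c + 5)            ≡⟨ regroup e d z c ⟩
  4 * (e + 1) + 3 * (2 * d) + (10 * z + 6) + 18 * c  ≤⟨ +-monoˡ-≤ (18 * c) (+-mono-≤ (+-mono-≤ (*-monoʳ-≤ 4 e<n) (*-monoʳ-≤ 3 2d≤n)) z-small) ⟩
  4 * n + 3 * n + 2 * n + 18 * c                     ≡⟨ collect n c ⟩
  9 * n + 18 * c                                     ∎)
  where
  open ≤-Reasoning
  double : ∀ n → 9 * n + n ≡ 2 * (5 * n)
  double = solve-∀
  regroup : ∀ e d z c → 2 * (2 * e + 3 * d + 5 * z + 9 * c + 5) ≡ 4 * (e + 1) + 3 * (2 * d) + (10 * z + 6) + 18 * c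
  regroup = solve-∀
  collect : ∀ n c → 4 * n + 3 * n + 2 * n + 18 * c ≡ 9 * n + 18 * c
  collect = solve-∀

module _ {n : ℕ} (G : Graph n) where
  open Graph G using (adj; irrefl) renaming (sym to adj-sym)

  deg-∑ : ∀ v → deg G v ≡ ∑[ u < n ] 𝟙 (adj v u)
  deg-∑ v = ∣tabulate∣≡# (adj v)

  -- An adjacency between i and j is counted by edgeCount at the smaller endpoint only.
  adj-split : ∀ i j → 𝟙 (adj i j) ≡ 𝟙 (adj i j ∧ (toℕ i <ᵇ toℕ j)) + 𝟙 (adj j i ∧ (toℕ j <ᵇ toℕ i))
  adj-split i j rewrite adj-sym j i
    with adj i j in i~j | toℕ i <ᵇ toℕ j | <ᵇ-reflects-< (toℕ i) (toℕ j)
                        | toℕ j <ᵇ toℕ i | <ᵇ-reflects-< (toℕ j) (toℕ i)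
  ... | false | _    | _        | _     | _        = refl
  ... | true  | true | _        | false | _        = refl
  ... | true  | false | _       | true  | _        = refl
  ... | true  | true | ofʸ i<j  | true  | ofʸ j<i  = contradiction j<i (<-asym i<j)
  ... | true  | false | ofⁿ i≮j | false | ofⁿ j≮i =
    contradiction (trans (sym (irrefl i)) (trans (cong (adj i) i≡j) i~j)) λ ()
    where
    i≡j : i ≡ j
    i≡j = toℕ-injective (≤-antisym (≮⇒≥ j≮i) (≮⇒≥ i≮j))

  handshake : ∑[ u < n ] deg G u ≡ 2 * edgeCount G
  handshake = begin
    ∑[ i < n ] deg G i                                    ≡⟨ ∑-cong (λ i → trans (deg-∑ i) (∑-cong (adj-split i))) ⟩
    ∑[ i < n ] ∑[ j < n ] (e i j + e j i)                 ≡⟨ ∑-cong (λ i → ∑-distrib-+ (e i) (λ j → e j i)) ⟩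
    ∑[ i < n ] (∑[ j < n ] e i j + ∑[ j < n ] e j i)      ≡⟨ ∑-distrib-+ (λ i → ∑[ j < n ] e i j) (λ i → ∑[ j < n ] e j i) ⟩
    E + ∑[ i < n ] ∑[ j < n ] e j i                       ≡⟨ cong (E +_) (∑-comm (λ i j → e j i)) ⟩
    E + E                                                 ≡⟨ cong (E +_) (+-identityʳ E) ⟨
    2 * E                                                 ≡⟨ cong (2 *_) edgeCount-∑ ⟨
    2 * edgeCount G                                       ∎
    where
    open ≡-Reasoning
    e : Fin n → Fin n → ℕ
    e i j = 𝟙 (adj i j ∧ (toℕ i <ᵇ toℕ j))
    E : ℕ
    E = ∑[ i < n ] ∑[ j < n ] e i j
    edgeCount-∑ : edgeCount G ≡ E
    edgeCount-∑ = trans (sum-allFin (λ i → ∣ tabulate (λ j → adj i j ∧ (toℕ i <ᵇ toℕ j)) ∣))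
                        (∑-cong (λ i → ∣tabulate∣≡# (λ j → adj i j ∧ (toℕ i <ᵇ toℕ j))))

  weighted-nbrs≤deg : ∀ u (g : Fin n → ℕ) → (∀ x → g x ≤ 1) → ∑[ x < n ] (g x * 𝟙 (adj u x)) ≤ deg G u
  weighted-nbrs≤deg u g g≤1 = begin
    ∑[ x < n ] (g x * 𝟙 (adj u x))  ≤⟨ ∑-mono (λ x → ≤-trans (*-monoˡ-≤ (𝟙 (adj u x)) (g≤1 x)) (≤-reflexive (*-identityˡ _))) ⟩
    ∑[ x < n ] 𝟙 (adj u x)          ≡⟨ deg-∑ u ⟨
    deg G u                         ∎
    where open ≤-Reasoning

  adj≤deg : ∀ u v → 𝟙 (adj u v) ≤ deg G u
  adj≤deg u v = subst (_≤ deg G u) (∑-point v (λ x → 𝟙 (adj u x)))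
                      (weighted-nbrs≤deg u (λ x → 𝟙[ v ≡ x ]) (λ x → 𝟙≤1 _))

  adj₂≤deg : ∀ u v w → v ≢ w → 𝟙 (adj u v) + 𝟙 (adj u w) ≤ deg G u
  adj₂≤deg u v w v≢w = begin
    𝟙 (adj u v) + 𝟙 (adj u w)
      ≡⟨ cong₂ _+_ (∑-point v a) (∑-point w a) ⟨
    ∑[ x < n ] (𝟙[ v ≡ x ] * a x) + ∑[ x < n ] (𝟙[ w ≡ x ] * a x)
      ≡⟨ ∑-distrib-+ (λ x → 𝟙[ v ≡ x ] * a x) (λ x → 𝟙[ w ≡ x ] * a x) ⟨
    ∑[ x < n ] (𝟙[ v ≡ x ] * a x + 𝟙[ w ≡ x ] * a x)
      ≡⟨ ∑-cong (λ x → *-distribʳ-+ (a x) (𝟙[ v ≡ x ]) (𝟙[ w ≡ x ])) ⟨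
    ∑[ x < n ] ((𝟙[ v ≡ x ] + 𝟙[ w ≡ x ]) * a x)
      ≤⟨ weighted-nbrs≤deg u (λ x → 𝟙[ v ≡ x ] + 𝟙[ w ≡ x ]) at-most-one ⟩
    deg G u ∎
    where
    open ≤-Reasoning
    a : Fin n → ℕ
    a x = 𝟙 (adj u x)
    at-most-one : ∀ x → 𝟙[ v ≡ x ] + 𝟙[ w ≡ x ] ≤ 1
    at-most-one x with v ≟ x | w ≟ x
    ... | yes refl | yes refl = contradiction refl v≢w
    ... | yes _    | no _     = ≤-refl
    ... | no _     | yes _    = ≤-refl
    ... | no _     | no _     = z≤n

  ∑-adj : ∀ v → ∑[ u < n ] 𝟙 (adj u v) ≡ deg G v
  ∑-adj v = trans (∑-cong (λ u → cong 𝟙 (adj-sym u v))) (sym (deg-∑ v))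

  closedNbhd-lookup : ∀ v u → lookup (closedNbhd G v) u ≡ does (v ≟ u) ∨ adj v u
  closedNbhd-lookup v u = trans (lookup-zipWith _∨_ u ⁅ v ⁆ (nbhd G v))
                                (cong₂ _∨_ (lookup-⁅⁆ v u) (lookup∘tabulate (adj v) u))

  outside : Fin n → Fin n → Bool
  outside v u = not (lookup (closedNbhd G v) u)

  closedNbhd-partition : ∀ v u → 𝟙 (outside v u) + 𝟙 (adj v u) + 𝟙[ v ≡ u ] ≡ 1
  closedNbhd-partition v u rewrite closedNbhd-lookup v u with v ≟ u
  ... | yes refl rewrite irrefl v = refl
  ... | no _ with adj v u
  ...   | true  = refl
  ...   | false = refl

  closedNbhd-size : ∀ v → ∑[ u < n ] (𝟙 (adj v u) + 𝟙[ v ≡ u ]) ≡ deg G v + 1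
  closedNbhd-size v = begin
    ∑[ u < n ] (𝟙 (adj v u) + 𝟙[ v ≡ u ])
      ≡⟨ ∑-distrib-+ (λ u → 𝟙 (adj v u)) (λ u → 𝟙[ v ≡ u ]) ⟩
    ∑[ u < n ] 𝟙 (adj v u) + ∑[ u < n ] 𝟙[ v ≡ u ]
      ≡⟨ cong₂ _+_ (deg-∑ v) (sym (∑-indicator v)) ⟨
    deg G v + 1 ∎
    where open ≡-Reasoning

  outside-size : ∀ v → # (outside v) + deg G v + 1 ≡ n
  outside-size v = begin
    # (outside v) + deg G v + 1                                ≡⟨ +-assoc (# (outside v)) (deg G v) 1 ⟩
    # (outside v) + (deg G v + 1)                              ≡⟨ cong (# (outside v) +_) (closedNbhd-size v) ⟨
    # (outside v) + ∑[ u < n ] (𝟙 (adj v u) + 𝟙[ v ≡ u ])      ≡⟨ ∑-distrib-+ (𝟙 ∘ outside v) (λ u → 𝟙 (adj v u) + 𝟙[ v ≡ u ]) ⟨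
    ∑[ u < n ] (𝟙 (outside v u) + (𝟙 (adj v u) + 𝟙[ v ≡ u ]))   ≡⟨ ∑-cong (λ u → trans (sym (+-assoc (𝟙 (outside v u)) _ _)) (closedNbhd-partition v u)) ⟩
    ∑[ u < n ] 1                                               ≡⟨ trans (∑-const n 1) (*-identityʳ n) ⟩
    n                                                          ∎
    where open ≡-Reasoning

  -- Pointwise form of outside-degrees: a vertex outside N[v] contributes its degree,
  -- a neighbour of v contributes its edge to v, and v contributes d(v).
  outside-degrees-pointwise : ∀ v u →
    𝟙 (outside v u) * deg G u + 𝟙 (adj u v) + 𝟙[ v ≡ u ] * deg G v ≤ deg G u
  outside-degrees-pointwise v u rewrite closedNbhd-lookup v u | adj-sym u v with v ≟ u
  ... | yes refl rewrite irrefl v = ≤-reflexive (+-identityʳ _)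
  ... | no _ with adj v u in v~u
  ...   | true  = subst (λ b → 𝟙 b ≤ deg G u) (trans (adj-sym u v) v~u) (adj≤deg u v)
  ...   | false = ≤-reflexive (trans (+-identityʳ _) (trans (+-identityʳ _) (+-identityʳ _)))

  outside-degrees : ∀ v → ∑[ u ∈ outside v ] deg G u + 2 * deg G v ≤ 2 * edgeCount G
  outside-degrees v = begin
    ∑[ u ∈ outside v ] deg G u + 2 * deg G v
      ≡⟨ cong (∑[ u ∈ outside v ] deg G u +_) (cong (deg G v +_) (+-identityʳ (deg G v))) ⟩
    ∑[ u ∈ outside v ] deg G u + (deg G v + deg G v)
      ≡⟨ cong₂ (λ x y → ∑[ u ∈ outside v ] deg G u + (x + y)) (∑-adj v) (∑-point v (λ _ → deg G v)) ⟨
    ∑[ u < n ] (𝟙 (outside v u) * deg G u) + (∑[ u < n ] 𝟙 (adj u v) + ∑[ u < n ] (𝟙[ v ≡ u ] * deg G v))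
      ≡⟨ cong (∑[ u ∈ outside v ] deg G u +_) (∑-distrib-+ (λ u → 𝟙 (adj u v)) (λ u → 𝟙[ v ≡ u ] * deg G v)) ⟨
    ∑[ u < n ] (𝟙 (outside v u) * deg G u) + ∑[ u < n ] (𝟙 (adj u v) + 𝟙[ v ≡ u ] * deg G v)
      ≡⟨ ∑-distrib-+ (λ u → 𝟙 (outside v u) * deg G u) (λ u → 𝟙 (adj u v) + 𝟙[ v ≡ u ] * deg G v) ⟨
    ∑[ u < n ] (𝟙 (outside v u) * deg G u + (𝟙 (adj u v) + 𝟙[ v ≡ u ] * deg G v))
      ≤⟨ ∑-mono (λ u → ≤-trans (≤-reflexive (sym (+-assoc (𝟙 (outside v u) * deg G u) (𝟙 (adj u v)) _))) (outside-degrees-pointwise v u)) ⟩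
    ∑[ u < n ] deg G u
      ≡⟨ handshake ⟩
    2 * edgeCount G ∎
    where open ≤-Reasoning

  -- Pointwise form of pair-degrees: each vertex u accounts for its edges to v and to w,
  -- where the edge vw (if present) is charged to its endpoints.
  pair-degrees-pointwise : ∀ v w u → v ≢ w →
    𝟙 (adj u v) + 𝟙 (adj u w) + (𝟙[ v ≡ u ] * deg G v + 𝟙[ w ≡ u ] * deg G w)
      ≤ deg G u + (𝟙[ v ≡ u ] + 𝟙[ w ≡ u ]) * 𝟙 (adj v w)
  pair-degrees-pointwise v w u v≢w with v ≟ u | w ≟ u
  ... | yes refl | yes refl = contradiction refl v≢w
  ... | yes refl | no _ rewrite irrefl v =
    ≤-reflexive (rearrange (𝟙 (adj v w)) (deg G v))
    where
    rearrange : ∀ a d → a + (d + 0 + 0) ≡ d + (a + 0)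
    rearrange = solve-∀
  ... | no _ | yes refl rewrite irrefl w | adj-sym w v =
    ≤-reflexive (rearrange (𝟙 (adj v w)) (deg G w))
    where
    rearrange : ∀ a d → a + 0 + (d + 0) ≡ d + (a + 0)
    rearrange = solve-∀
  ... | no _ | no _ =
    ≤-trans (≤-reflexive (+-identityʳ _)) (≤-trans (adj₂≤deg u v w v≢w) (≤-reflexive (sym (+-identityʳ _))))

  -- Two distinct vertices have at most e + 1 incident edge-ends: only the edge vw is shared.
  pair-degrees : ∀ v w → v ≢ w → deg G v + deg G w ≤ edgeCount G + 1
  pair-degrees v w v≢w = *-cancelˡ-≤ 2 (begin
    2 * (d v + d w)
      ≡⟨ cong (d v + d w +_) (+-identityʳ (d v + d w)) ⟩
    (d v + d w) + (d v + d w)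
      ≡⟨ cong₂ _+_ (cong₂ _+_ (∑-adj v) (∑-adj w)) (cong₂ _+_ (∑-point v (λ _ → d v)) (∑-point w (λ _ → d w))) ⟨
    (∑[ u < n ] 𝟙 (adj u v) + ∑[ u < n ] 𝟙 (adj u w)) + (∑[ u < n ] (𝟙[ v ≡ u ] * d v) + ∑[ u < n ] (𝟙[ w ≡ u ] * d w))
      ≡⟨ cong₂ _+_ (∑-distrib-+ (λ u → 𝟙 (adj u v)) (λ u → 𝟙 (adj u w)))
                   (∑-distrib-+ (λ u → 𝟙[ v ≡ u ] * d v) (λ u → 𝟙[ w ≡ u ] * d w)) ⟨
    ∑[ u < n ] (𝟙 (adj u v) + 𝟙 (adj u w)) + ∑[ u < n ] (𝟙[ v ≡ u ] * d v + 𝟙[ w ≡ u ] * d w)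
      ≡⟨ ∑-distrib-+ (λ u → 𝟙 (adj u v) + 𝟙 (adj u w)) (λ u → 𝟙[ v ≡ u ] * d v + 𝟙[ w ≡ u ] * d w) ⟨
    ∑[ u < n ] (𝟙 (adj u v) + 𝟙 (adj u w) + (𝟙[ v ≡ u ] * d v + 𝟙[ w ≡ u ] * d w))
      ≤⟨ ∑-mono (λ u → pair-degrees-pointwise v w u v≢w) ⟩
    ∑[ u < n ] (d u + (𝟙[ v ≡ u ] + 𝟙[ w ≡ u ]) * a)
      ≡⟨ ∑-distrib-+ d (λ u → (𝟙[ v ≡ u ] + 𝟙[ w ≡ u ]) * a) ⟩
    ∑[ u < n ] d u + ∑[ u < n ] ((𝟙[ v ≡ u ] + 𝟙[ w ≡ u ]) * a)
      ≡⟨ cong (∑[ u < n ] d u +_) (∑-cong (λ u → *-distribʳ-+ a (𝟙[ v ≡ u ]) (𝟙[ w ≡ u ]))) ⟩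
    ∑[ u < n ] d u + ∑[ u < n ] (𝟙[ v ≡ u ] * a + 𝟙[ w ≡ u ] * a)
      ≡⟨ cong₂ _+_ handshake (trans (∑-distrib-+ (λ u → 𝟙[ v ≡ u ] * a) (λ u → 𝟙[ w ≡ u ] * a))
                                    (cong₂ _+_ (∑-point v (λ _ → a)) (∑-point w (λ _ → a)))) ⟩
    2 * edgeCount G + (a + a)
      ≤⟨ +-monoʳ-≤ (2 * edgeCount G) (+-mono-≤ (𝟙≤1 (adj v w)) (𝟙≤1 (adj v w))) ⟩
    2 * edgeCount G + 2
      ≡⟨ *-distribˡ-+ 2 (edgeCount G) 1 ⟨
    2 * (edgeCount G + 1) ∎)
    where
    open ≤-Reasoning
    d : Fin n → ℕ
    d = deg G
    a : ℕ
    a = 𝟙 (adj v w)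

  outside-char : ∀ v u → outside v u ≡ true → v ≢ u × adj v u ≡ false
  outside-char v u u-out = characterise (trans (sym (cong not (closedNbhd-lookup v u))) u-out)
    where
    characterise : not (does (v ≟ u) ∨ adj v u) ≡ true → v ≢ u × adj v u ≡ false
    characterise h with v ≟ u | adj v u
    ... | yes _   | _     = contradiction h λ ()
    ... | no _    | true  = contradiction h λ ()
    ... | no v≢u  | false = v≢u , refl

  record LowDegreeIndependent (W : Fin n → Bool) (c : ℕ) : Set where
    field
      I     : Fin n → Bool
      I⊆W   : ∀ u → I u ≡ true → W u ≡ true
      low   : ∀ u → I u ≡ true → deg G u < c
      indep : ∀ u w → I u ≡ true → I w ≡ true → adj u w ≡ false

  _∖N[_] : (Fin n → Bool) → Fin n → Fin n → Bool
  (W ∖N[ v ]) u = W u ∧ outside v u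

  -- The greedy algorithm: repeatedly pick a vertex v of minimum degree in W and delete N[v].
  -- A vertex u ∈ W has weight c ∸ d(u); every step deletes at most (d(v) + 1)(c ∸ d(v)) ≤ K weight,
  -- so the total weight of W is at most K times the number of chosen vertices.
  module Greedy (c K : ℕ) (K-bound : ∀ d → suc d * (c ∸ d) ≤ K) where
    open LowDegreeIndependent

    Pays : (W : Fin n → Bool) → LowDegreeIndependent W c → Set
    Pays W S = ∑[ u ∈ W ] (c ∸ deg G u) ≤ K * # (I S)

    weightless : ∀ W → (∀ u → W u ≡ true → c ∸ deg G u ≡ 0) → Σ (LowDegreeIndependent W c) (Pays W)
    weightless W no-weight =
      record { I = λ _ → false ; I⊆W = λ _ () ; low = λ _ () ; indep = λ _ _ () } ,
      ≤-trans (∑-mono free) (≤-trans (≤-reflexive (∑-zero n)) z≤n)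
      where
      free : ∀ u → 𝟙 (W u) * (c ∸ deg G u) ≤ 0
      free u with W u in u∈W
      ... | false = z≤n
      ... | true  = ≤-reflexive (trans (+-identityʳ _) (no-weight u u∈W))

    shrink : ∀ W v → W v ≡ true → # (W ∖N[ v ]) < # W
    shrink W v v∈W = ≤-trans (≤-reflexive (+-comm 1 (# (W ∖N[ v ])))) (begin
      # (W ∖N[ v ]) + 1                              ≡⟨ cong (# (W ∖N[ v ]) +_) (∑-indicator v) ⟨
      # (W ∖N[ v ]) + ∑[ u < n ] 𝟙[ v ≡ u ]          ≡⟨ ∑-distrib-+ (𝟙 ∘ (W ∖N[ v ])) (λ u → 𝟙[ v ≡ u ]) ⟨
      ∑[ u < n ] (𝟙 ((W ∖N[ v ]) u) + 𝟙[ v ≡ u ])    ≤⟨ ∑-mono counted-once ⟩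
      # W                                            ∎)
      where
      open ≤-Reasoning
      counted-once : ∀ u → 𝟙 ((W ∖N[ v ]) u) + 𝟙[ v ≡ u ] ≤ 𝟙 (W u)
      counted-once u with v ≟ u | W u in u∈W | outside v u in u-out
      ... | yes refl | true  | true  = contradiction refl (proj₁ (outside-char v v u-out))
      ... | yes refl | true  | false = ≤-refl
      ... | yes refl | false | _     = contradiction (trans (sym v∈W) u∈W) λ ()
      ... | no _     | false | _     = z≤n
      ... | no _     | true  | true  = ≤-refl
      ... | no _     | true  | false = z≤n

    rest-outside : ∀ W v (S : LowDegreeIndependent (W ∖N[ v ]) c) u → I S u ≡ true →
                   W u ≡ true × outside v u ≡ true
    rest-outside W v S u u∈I with W u | outside v u | I⊆W S u u∈I
    ... | true | true | _ = refl , refl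

    insert : ∀ W v → W v ≡ true → deg G v < c →
             LowDegreeIndependent (W ∖N[ v ]) c → LowDegreeIndependent W c
    insert W v v∈W dv<c S = record { I = I⁺ ; I⊆W = I⁺⊆W ; low = I⁺-low ; indep = I⁺-indep }
      where
      I⁺ : Fin n → Bool
      I⁺ u = does (v ≟ u) ∨ I S u
      I⁺⊆W : ∀ u → I⁺ u ≡ true → W u ≡ true
      I⁺⊆W u u∈I⁺ with v ≟ u
      ... | yes refl = v∈W
      ... | no _     = proj₁ (rest-outside W v S u u∈I⁺)
      I⁺-low : ∀ u → I⁺ u ≡ true → deg G u < c
      I⁺-low u u∈I⁺ with v ≟ u
      ... | yes refl = dv<c
      ... | no _     = low S u u∈I⁺
      I⁺-indep : ∀ u w → I⁺ u ≡ true → I⁺ w ≡ true → adj u w ≡ false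
      I⁺-indep u w u∈I⁺ w∈I⁺ with v ≟ u | v ≟ w
      ... | yes refl | yes refl = irrefl v
      ... | yes refl | no _     = proj₂ (outside-char v w (proj₂ (rest-outside W v S w w∈I⁺)))
      ... | no _     | yes refl = trans (adj-sym u v) (proj₂ (outside-char v u (proj₂ (rest-outside W v S u u∈I⁺))))
      ... | no _     | no _     = indep S u w u∈I⁺ w∈I⁺

    -- v is new: it lies in N[v], hence not in the old solution.
    insert-size : ∀ W v v∈W dv<c (S : LowDegreeIndependent (W ∖N[ v ]) c) →
                  # (I (insert W v v∈W dv<c S)) ≡ 1 + # (I S)
    insert-size W v v∈W dv<c S = begin
      # (I (insert W v v∈W dv<c S))                ≡⟨ ∑-cong new ⟩
      ∑[ u < n ] (𝟙[ v ≡ u ] + 𝟙 (I S u))          ≡⟨ ∑-distrib-+ (λ u → 𝟙[ v ≡ u ]) (𝟙 ∘ I S) ⟩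
      ∑[ u < n ] 𝟙[ v ≡ u ] + # (I S)              ≡⟨ cong (_+ # (I S)) (∑-indicator v) ⟩
      1 + # (I S)                                  ∎
      where
      open ≡-Reasoning
      new : ∀ u → 𝟙 (does (v ≟ u) ∨ I S u) ≡ 𝟙[ v ≡ u ] + 𝟙 (I S u)
      new u with v ≟ u | I S u in u∈I
      ... | no _     | _     = refl
      ... | yes refl | false = refl
      ... | yes refl | true  = contradiction refl (proj₁ (outside-char v v (proj₂ (rest-outside W v S v u∈I))))

    -- The weight of u ∈ W is charged to W ∖ N[v] or, if u ∈ N[v], to the vertex v,
    -- whose weight is the largest in W.
    charge : ∀ W v → (∀ u → W u ≡ true → deg G v ≤ deg G u) → ∀ u →
             𝟙 (W u) * (c ∸ deg G u)
               ≤ 𝟙 ((W ∖N[ v ]) u) * (c ∸ deg G u) + (𝟙 (adj v u) + 𝟙[ v ≡ u ]) * (c ∸ deg G v)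
    charge W v v-min u with W u in u∈W | outside v u in u-out
    ... | false | _     = z≤n
    ... | true  | true  = m≤m+n _ _
    ... | true  | false = begin
      c ∸ deg G u + 0                                ≡⟨ +-identityʳ _ ⟩
      c ∸ deg G u                                    ≤⟨ ∸-monoʳ-≤ c (v-min u u∈W) ⟩
      c ∸ deg G v                                    ≡⟨ *-identityˡ _ ⟨
      1 * (c ∸ deg G v)                              ≡⟨ cong (_* (c ∸ deg G v)) in-N[v] ⟨
      (𝟙 (adj v u) + 𝟙[ v ≡ u ]) * (c ∸ deg G v)     ∎
      where
      open ≤-Reasoning
      in-N[v] : 𝟙 (adj v u) + 𝟙[ v ≡ u ] ≡ 1
      in-N[v] = trans (sym (+-assoc 0 (𝟙 (adj v u)) _))
                      (trans (cong (λ b → 𝟙 b + 𝟙 (adj v u) + 𝟙[ v ≡ u ]) (sym u-out)) (closedNbhd-partition v u))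

    add-vertex : ∀ W v → W v ≡ true → (∀ u → W u ≡ true → deg G v ≤ deg G u) → deg G v < c →
                 Σ (LowDegreeIndependent (W ∖N[ v ]) c) (Pays (W ∖N[ v ])) →
                 Σ (LowDegreeIndependent W c) (Pays W)
    add-vertex W v v∈W v-min dv<c (S , S-pays) = insert W v v∈W dv<c S , (begin
      ∑[ u ∈ W ] (c ∸ deg G u)
        ≤⟨ ∑-mono (charge W v v-min) ⟩
      ∑[ u < n ] (𝟙 ((W ∖N[ v ]) u) * (c ∸ deg G u) + (𝟙 (adj v u) + 𝟙[ v ≡ u ]) * (c ∸ deg G v))
        ≡⟨ ∑-distrib-+ (λ u → 𝟙 ((W ∖N[ v ]) u) * (c ∸ deg G u)) (λ u → (𝟙 (adj v u) + 𝟙[ v ≡ u ]) * (c ∸ deg G v)) ⟩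
      ∑[ u ∈ W ∖N[ v ] ] (c ∸ deg G u) + ∑[ u < n ] ((𝟙 (adj v u) + 𝟙[ v ≡ u ]) * (c ∸ deg G v))
        ≡⟨ cong (∑[ u ∈ W ∖N[ v ] ] (c ∸ deg G u) +_)
                (trans (sym (*-distribʳ-sum (c ∸ deg G v) (λ u → 𝟙 (adj v u) + 𝟙[ v ≡ u ])))
                       (cong (_* (c ∸ deg G v)) (trans (closedNbhd-size v) (+-comm (deg G v) 1)))) ⟩
      ∑[ u ∈ W ∖N[ v ] ] (c ∸ deg G u) + suc (deg G v) * (c ∸ deg G v)
        ≤⟨ +-mono-≤ S-pays (K-bound (deg G v)) ⟩
      K * # (I S) + K
        ≡⟨ trans (+-comm (K * # (I S)) K) (sym (*-suc K (# (I S)))) ⟩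
      K * (1 + # (I S))
        ≡⟨ cong (K *_) (insert-size W v v∈W dv<c S) ⟨
      K * # (I (insert W v v∈W dv<c S)) ∎)
      where open ≤-Reasoning

    greedy : ∀ W → Acc _<_ (# W) → Σ (LowDegreeIndependent W c) (Pays W)
    greedy W (acc smaller) with minimiser W (deg G)
    ... | inj₁ W-empty = weightless W (λ u u∈W → contradiction (trans (sym u∈W) (W-empty u)) λ ())
    ... | inj₂ (v , v∈W , v-min) with c ≤? deg G v
    ...   | yes c≤dv = weightless W (λ u u∈W → m≤n⇒m∸n≡0 (≤-trans c≤dv (v-min u u∈W)))
    ...   | no c≰dv  = add-vertex W v v∈W v-min (≰⇒> c≰dv)
                                  (greedy (W ∖N[ v ]) (smaller (shrink W v v∈W)))

  low-degree-independent : ∀ c K → (∀ d → suc d * (c ∸ d) ≤ K) → ∀ W →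
    Σ (LowDegreeIndependent W c) λ S → c * # W ≤ ∑[ u ∈ W ] deg G u + K * # (LowDegreeIndependent.I S)
  low-degree-independent c K K-bound W with Greedy.greedy c K K-bound W (<-wellFounded (# W))
  ... | S , S-pays = S , (begin
    c * # W                                                        ≡⟨ *-distribˡ-sum c (𝟙 ∘ W) ⟩
    ∑[ u < n ] (c * 𝟙 (W u))                                       ≤⟨ ∑-mono (λ u → split (W u) (deg G u)) ⟩
    ∑[ u < n ] (𝟙 (W u) * deg G u + 𝟙 (W u) * (c ∸ deg G u))       ≡⟨ ∑-distrib-+ (λ u → 𝟙 (W u) * deg G u) (λ u → 𝟙 (W u) * (c ∸ deg G u)) ⟩
    ∑[ u ∈ W ] deg G u + ∑[ u ∈ W ] (c ∸ deg G u)                  ≤⟨ +-monoʳ-≤ (∑[ u ∈ W ] deg G u) S-pays ⟩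
    ∑[ u ∈ W ] deg G u + K * # (LowDegreeIndependent.I S)          ∎)
    where
    open ≤-Reasoning
    split : ∀ b d → c * 𝟙 b ≤ 𝟙 b * d + 𝟙 b * (c ∸ d)
    split b d = ≤-trans (≤-reflexive (*-comm c (𝟙 b)))
                        (≤-trans (*-monoʳ-≤ (𝟙 b) (m≤n+m∸n c d)) (≤-reflexive (*-distribˡ-+ (𝟙 b) d (c ∸ d))))

  closedNbhdSet-size : ∀ B → ∣ closedNbhdSet G B ∣ ≤ ∣ B ∣ + ∑[ w ∈ lookup B ] deg G w
  closedNbhdSet-size B = begin
    ∣ closedNbhdSet G B ∣                                ≤⟨ ∣p∪q∣≤∣p∣+∣q∣ B (⋃ (List.map N (List.allFin n))) ⟩
    ∣ B ∣ + ∣ ⋃ (List.map N (List.allFin n)) ∣            ≤⟨ +-monoʳ-≤ ∣ B ∣ (∣⋃∣≤sum (List.map N (List.allFin n))) ⟩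
    ∣ B ∣ + sum (List.map ∣_∣ (List.map N (List.allFin n)))
                                                        ≡⟨ cong (λ xs → ∣ B ∣ + sum xs) (map-∘ (List.allFin n)) ⟨
    ∣ B ∣ + sum (List.map (∣_∣ ∘ N) (List.allFin n))      ≡⟨ cong (∣ B ∣ +_) (sum-allFin (∣_∣ ∘ N)) ⟩
    ∣ B ∣ + ∑[ w < n ] ∣ N w ∣                            ≡⟨ cong (∣ B ∣ +_) (∑-cong ∣N∣) ⟩
    ∣ B ∣ + ∑[ w ∈ lookup B ] deg G w                     ∎
    where
    open ≤-Reasoning
    N : Fin n → Subset n
    N w = if lookup B w then nbhd G w else ⊥
    ∣N∣ : ∀ w → ∣ N w ∣ ≡ 𝟙 (lookup B w) * deg G w
    ∣N∣ w with lookup B w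
    ... | true  = sym (+-identityʳ (deg G w))
    ... | false = ∣⊥∣≡0 n

module _ {n : ℕ} (G : Graph n) where
  open LowDegreeIndependent

  sparse-outside : ∀ v → Σ (LowDegreeIndependent G (outside G v) 2) λ S → n ≤ edgeCount G + 1 + # (I S)
  sparse-outside v with low-degree-independent G 2 2 weight-bound₂ (outside G v)
  ... | S , bound = S , *-cancelˡ-≤ 2 (begin
    2 * n                      ≡⟨ cong (2 *_) (outside-size G v) ⟨
    2 * (s + d + 1)            ≡⟨ expand s d ⟩
    2 * s + 2 * d + 2          ≤⟨ +-monoˡ-≤ 2 (+-monoˡ-≤ (2 * d) bound) ⟩
    X + 2 * c + 2 * d + 2      ≡⟨ regroup X c d ⟩
    X + 2 * d + 2 * c + 2      ≤⟨ +-monoˡ-≤ 2 (+-monoˡ-≤ (2 * c) (outside-degrees G v)) ⟩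
    2 * e + 2 * c + 2          ≡⟨ collect e c ⟩
    2 * (e + 1 + c)            ∎)
    where
    open ≤-Reasoning
    s = # (outside G v)
    d = deg G v
    X = ∑[ u ∈ outside G v ] deg G u
    c = # (I S)
    e = edgeCount G
    expand : ∀ s d → 2 * (s + d + 1) ≡ 2 * s + 2 * d + 2
    expand = solve-∀
    regroup : ∀ X c d → X + 2 * c + 2 * d + 2 ≡ X + 2 * d + 2 * c + 2
    regroup = solve-∀
    collect : ∀ e c → 2 * e + 2 * c + 2 ≡ 2 * (e + 1 + c)
    collect = solve-∀

  sparse-outside-avoiding : ∀ v Z → Σ (LowDegreeIndependent G (outside G v ∖ Z) 5) λ S →
                            5 * n ≤ 2 * edgeCount G + 3 * deg G v + 5 * # Z + 9 * # (I S) + 5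
  sparse-outside-avoiding v Z with low-degree-independent G 5 9 weight-bound₅ (outside G v ∖ Z)
  ... | S , bound = S , (begin
    5 * n                              ≡⟨ cong (5 *_) (outside-size G v) ⟨
    5 * (s + d + 1)                    ≡⟨ expand s d ⟩
    5 * s + 5 * d + 5                  ≤⟨ +-monoˡ-≤ 5 (+-monoˡ-≤ (5 * d) remaining) ⟩
    X + 9 * c + 5 * z + 5 * d + 5      ≡⟨ regroup X c z d ⟩
    X + 2 * d + 3 * d + 5 * z + 9 * c + 5
        ≤⟨ +-monoˡ-≤ 5 (+-monoˡ-≤ (9 * c) (+-monoˡ-≤ (5 * z) (+-monoˡ-≤ (3 * d) (outside-degrees G v)))) ⟩
    2 * e + 3 * d + 5 * z + 9 * c + 5  ∎)
    where
    open ≤-Reasoning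
    s = # (outside G v)
    d = deg G v
    X = ∑[ u ∈ outside G v ] deg G u
    z = # Z
    c = # (I S)
    e = edgeCount G
    -- vertices outside N[v] either lie in Z or are candidates for I
    remaining : 5 * s ≤ X + 9 * c + 5 * z
    remaining = begin
      5 * s                                                    ≤⟨ *-monoʳ-≤ 5 (#-∖ (outside G v) Z) ⟩
      5 * (# (outside G v ∖ Z) + z)                            ≡⟨ *-distribˡ-+ 5 (# (outside G v ∖ Z)) z ⟩
      5 * # (outside G v ∖ Z) + 5 * z                          ≤⟨ +-monoˡ-≤ (5 * z) bound ⟩
      ∑[ u ∈ outside G v ∖ Z ] deg G u + 9 * c + 5 * z         ≤⟨ +-monoˡ-≤ (5 * z) (+-monoˡ-≤ (9 * c) (∑-∖ (outside G v) Z (deg G))) ⟩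
      X + 9 * c + 5 * z                                        ∎
    expand : ∀ s d → 5 * (s + d + 1) ≡ 5 * s + 5 * d + 5
    expand = solve-∀
    regroup : ∀ X c z d → X + 9 * c + 5 * z + 5 * d + 5 ≡ X + 2 * d + 3 * d + 5 * z + 9 * c + 5
    regroup = solve-∀

  small-closedNbhdSet : ∀ B δ → 1 ≤ δ → (200 * δ) ^ 2 ≤ n → ∣ B ∣ ≡ δ →
                        (∀ w → w ∈ B → deg G w ^ 2 < 4 * n) → 10 * ∣ closedNbhdSet G B ∣ + 6 ≤ 2 * n
  small-closedNbhdSet B δ 1≤δ hδ ∣B∣≡δ B-low = *-cancelˡ-≤ 100 (begin
    100 * (10 * z + 6)                  ≡⟨ expand z ⟩
    1000 * z + 600                      ≤⟨ +-monoˡ-≤ 600 (*-monoʳ-≤ 1000 z≤δ+Q) ⟩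
    1000 * (δ + Q) + 600                ≡⟨ regroup δ Q ⟩
    1000 * δ + 600 + 10 * (100 * Q)     ≤⟨ +-mono-≤ δ-part (*-monoʳ-≤ 10 Q-part) ⟩
    11 * n                              ≤⟨ *-monoˡ-≤ n (m≤m+n 11 189) ⟩
    200 * n                             ≡⟨ *-assoc 100 2 n ⟩
    100 * (2 * n)                       ∎)
    where
    open ≤-Reasoning
    expand : ∀ z → 100 * (10 * z + 6) ≡ 1000 * z + 600
    expand = solve-∀
    regroup : ∀ δ Q → 1000 * (δ + Q) + 600 ≡ 1000 * δ + 600 + 10 * (100 * Q)
    regroup = solve-∀
    square : ∀ δ → 40000 * (δ * δ) ≡ 200 * δ * (200 * δ * 1)
    square = solve-∀
    reassoc : ∀ δ Q → δ * (100 * Q) ≡ 100 * δ * Q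
    reassoc = solve-∀
    swap : ∀ a x y → a * (x * y) ≡ x * (a * y)
    swap = solve-∀
    z = ∣ closedNbhdSet G B ∣
    b : Fin n → Bool
    b = lookup B
    Q = ∑[ w ∈ b ] deg G w
    z≤δ+Q : z ≤ δ + Q
    z≤δ+Q = subst (λ k → z ≤ k + Q) ∣B∣≡δ (closedNbhdSet-size G B)
    δ-part : 1000 * δ + 600 ≤ n
    δ-part = begin
      1000 * δ + 600         ≤⟨ +-monoʳ-≤ (1000 * δ) (*-monoʳ-≤ 600 1≤δ) ⟩
      1000 * δ + 600 * δ     ≡⟨ *-distribʳ-+ δ 1000 600 ⟨
      1600 * δ               ≤⟨ *-monoʳ-≤ 1600 (m≤m*n δ δ {{>-nonZero 1≤δ}}) ⟩
      1600 * (δ * δ)         ≤⟨ *-monoˡ-≤ (δ * δ) (m≤m+n 1600 38400) ⟩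
      40000 * (δ * δ)        ≡⟨ square δ ⟩
      (200 * δ) ^ 2          ≤⟨ hδ ⟩
      n                      ∎
    -- each w ∈ B has 100 δ d(w) < n, and there are δ of them
    pointwise : ∀ w → 𝟙 (b w) * (100 * δ * deg G w) ≤ 𝟙 (b w) * n
    pointwise w with b w in w∈B
    ... | false = z≤n
    ... | true  = +-monoˡ-≤ 0 (<⇒≤ (product-bound δ (deg G w) n hδ (B-low w (lookup⇒[]= w B w∈B))))
    Q-part : 100 * Q ≤ n
    Q-part = *-cancelˡ-≤ δ {{>-nonZero 1≤δ}} (begin
      δ * (100 * Q)                                ≡⟨ reassoc δ Q ⟩
      100 * δ * Q                                  ≡⟨ *-distribˡ-sum (100 * δ) (λ w → 𝟙 (b w) * deg G w) ⟩
      ∑[ w < n ] (100 * δ * (𝟙 (b w) * deg G w))   ≡⟨ ∑-cong (λ w → swap (100 * δ) (𝟙 (b w)) (deg G w)) ⟩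
      ∑[ w < n ] (𝟙 (b w) * (100 * δ * deg G w))   ≤⟨ ∑-mono pointwise ⟩
      ∑[ w < n ] (𝟙 (b w) * n)                     ≡⟨ *-distribʳ-sum n (𝟙 ∘ b) ⟨
      # b * n                                      ≡⟨ cong (_* n) (trans (sym (∣p∣≡# B)) ∣B∣≡δ) ⟩
      δ * n                                        ∎)

  deg≤edgeCount : ∀ v → deg G v ≤ edgeCount G
  deg≤edgeCount v = *-cancelˡ-≤ 2 (≤-trans (m≤n+m (2 * deg G v) (∑[ u ∈ outside G v ] deg G u)) (outside-degrees G v))

  second-degree : ∀ v w → v ≢ w → deg G w ≤ deg G v → 2 * deg G w ≤ edgeCount G + 1
  second-degree v w v≢w dw≤dv = begin
    2 * deg G w               ≡⟨ cong (deg G w +_) (+-identityʳ (deg G w)) ⟩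
    deg G w + deg G w         ≤⟨ +-monoˡ-≤ (deg G w) dw≤dv ⟩
    deg G v + deg G w         ≤⟨ pair-degrees G v w v≢w ⟩
    edgeCount G + 1           ∎
    where open ≤-Reasoning

  outside⇒∉ : ∀ v u → outside G v u ≡ true → u ∉ closedNbhd G v
  outside⇒∉ v u u-out = ∉-lookup (closedNbhd G v) u (not-true u-out)

  ≤-maximum : ∀ {W c} (S : LowDegreeIndependent G W c)
              (Allowed : Fin n → Set) (Acceptable : ℕ → Set) →
              (∀ u → W u ≡ true → Allowed u) → (∀ d → d < c → Acceptable d) →
              (S₀ : Subset n) →
              (∀ T → (∀ u → u ∈ T → Allowed u) → Independent G T → (∀ u → u ∈ T → Acceptable (deg G u)) →
                 ∣ T ∣ ≤ ∣ S₀ ∣) →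
              # (I S) ≤ ∣ S₀ ∣
  ≤-maximum S Allowed Acceptable W⇒allowed low⇒acceptable S₀ maximum =
    subst (_≤ ∣ S₀ ∣) (∣tabulate∣≡# (I S)) (maximum (tabulate (I S))
      (λ u u∈T → W⇒allowed u (I⊆W S u (member u u∈T)))
      (λ u w u∈T w∈T → indep S u w (member u u∈T) (member w w∈T))
      (λ u u∈T → low⇒acceptable (deg G u) (low S u (member u u∈T))))
    where
    member : ∀ u → u ∈ tabulate (I S) → I S u ≡ true
    member = ∈-tabulate (I S)

⊓≤⊔ : ∀ {m} (xs : Vec ℕ (suc m)) → foldr₁ _⊓_ xs ≤ foldr₁ _⊔_ xs
⊓≤⊔ (x ∷ [])     = ≤-refl
⊓≤⊔ (x ∷ y ∷ ys) = ≤-trans (m⊓n≤m x _) (m≤m⊔n x _)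

foldr₁-⊓-glb : ∀ {m} k (xs : Vec ℕ (suc m)) → (∀ i → k ≤ lookup xs i) → k ≤ foldr₁ _⊓_ xs
foldr₁-⊓-glb k (x ∷ [])     k≤xs = k≤xs Fin.zero
foldr₁-⊓-glb k (x ∷ y ∷ ys) k≤xs = ⊓-glb (k≤xs Fin.zero) (foldr₁-⊓-glb k (y ∷ ys) (k≤xs ∘ Fin.suc))

minDegree≤maxDegree : ∀ {m} (H : Graph (suc m)) → minDegree H ≤ maxDegree H
minDegree≤maxDegree H = ⊓≤⊔ (tabulate (deg H))

NoIsolated⇒1≤minDegree : ∀ {m} (H : Graph (suc m)) → NoIsolated H → 1 ≤ minDegree H
NoIsolated⇒1≤minDegree H no-isolated =
  foldr₁-⊓-glb 1 (tabulate (deg H)) (λ v → subst (1 ≤_) (sym (lookup∘tabulate (deg H) v)) (no-isolated v))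

-- The setting of the lemma: n = m + 1 vertices, H without isolated vertices and with
-- 200 Δ(H) ≤ √n, G with e = n − δ − 1 edges, σ listing the vertices of G by non-increasing
-- degree, and S₁ a maximum independent set outside N[σ 0] of vertices of degree below 2√n.
module Lemma2p1 (m : ℕ) (H : Graph (suc m)) (no-isolated : NoIsolated H)
  (small-Δ : (200 * maxDegree H) ^ 2 ≤ suc m)
  (G : Graph (suc m)) (edges : edgeCount G ≡ suc m ∸ minDegree H ∸ 1)
  (σ : Fin (suc m) → Fin (suc m)) (σ-inj : Injective _≡_ _≡_ σ)
  (sorted : ∀ (i : Fin m) → deg G (σ (Fin.suc i)) ≤ deg G (σ (inject₁ i)))
  (S₁ : Subset (suc m))
  (S₁-deg : ∀ u → u ∈ S₁ → deg G u ^ 2 < 4 * suc m)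
  (S₁-maximum : ∀ (T : Subset (suc m)) →
    (∀ u → u ∈ T → u ∉ closedNbhd G (σ Fin.zero)) → Independent G T →
    (∀ u → u ∈ T → deg G u ^ 2 < 4 * suc m) → ∣ T ∣ ≤ ∣ S₁ ∣) where

  n = suc m
  δ = minDegree H
  e = edgeCount G
  v₁ = σ Fin.zero

  1≤δ : 1 ≤ δ
  1≤δ = NoIsolated⇒1≤minDegree H no-isolated

  small-δ : (200 * δ) ^ 2 ≤ n
  small-δ = ≤-trans (^-monoˡ-≤ 2 (*-monoʳ-≤ 200 (minDegree≤maxDegree H))) small-Δ

  δ+1≤n : δ + 1 ≤ n
  δ+1≤n = begin
    δ + 1          ≤⟨ +-monoʳ-≤ δ 1≤δ ⟩
    δ + δ          ≡⟨ cong (δ +_) (+-identityʳ δ) ⟨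
    2 * δ          ≤⟨ *-monoˡ-≤ δ (m≤m+n 2 198) ⟩
    200 * δ        ≤⟨ ≤-square (200 * δ) ⟩
    (200 * δ) ^ 2  ≤⟨ small-δ ⟩
    n              ∎
    where open ≤-Reasoning

  e+1+δ≡n : e + 1 + δ ≡ n
  e+1+δ≡n = begin
    e + 1 + δ                ≡⟨ +-assoc e 1 δ ⟩
    e + (1 + δ)              ≡⟨ cong (e +_) (+-comm 1 δ) ⟩
    e + (δ + 1)              ≡⟨ cong (_+ (δ + 1)) (trans edges (∸-+-assoc n δ 1)) ⟩
    n ∸ (δ + 1) + (δ + 1)    ≡⟨ m∸n+n≡m δ+1≤n ⟩
    n                        ∎
    where open ≡-Reasoning

  e+1≤n : e + 1 ≤ n
  e+1≤n = ≤-trans (m≤m+n (e + 1) δ) (≤-reflexive e+1+δ≡n)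

  e<n : e < n
  e<n = subst (_≤ n) (+-comm e 1) e+1≤n

  part1a : deg G v₁ ≤ n ∸ δ ∸ 1
  part1a = subst (deg G v₁ ≤_) edges (deg≤edgeCount G v₁)

  part1b : ∀ (i : Fin n) → toℕ i ≡ 1 → 2 * deg G (σ i) ≤ n
  part1b i i≡1 = ≤-trans (second-degree G v₁ (σ i) v₁≢σi (antitone (deg G ∘ σ) sorted Fin.zero i z≤n))
                         e+1≤n
    where
    v₁≢σi : v₁ ≢ σ i
    v₁≢σi v₁≡σi with trans (cong toℕ (σ-inj v₁≡σi)) i≡1
    ... | ()

  part1c : ∀ (i : Fin n) → (toℕ i + 1) * deg G (σ i) < 2 * n
  part1c i = ≤-<-trans (sorted-value-bound σ σ-inj (deg G) sorted i)
                       (subst (_< 2 * n) (sym (handshake G)) (*-monoʳ-< 2 e<n))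

  part2a : δ ≤ ∣ S₁ ∣
  part2a =
    let S , large = sparse-outside G v₁ in
    ≤-trans (+-cancelˡ-≤ (e + 1) δ (# (I S)) (≤-trans (≤-reflexive e+1+δ≡n) large))
            (≤-maximum G S (λ u → u ∉ closedNbhd G v₁) (λ d → d ^ 2 < 4 * n)
                       (outside⇒∉ G v₁) low-square S₁ S₁-maximum)
    where
    open LowDegreeIndependent
    low-square : ∀ d → d < 2 → d ^ 2 < 4 * n
    low-square d d<2 = ≤-trans (s≤s (^-monoˡ-≤ 2 (s≤s⁻¹ d<2))) (≤-trans (m≤m+n 2 2) (m≤m*n 4 n))

  later-degree : ∀ (i : Fin n) → 1 ≤ toℕ i → 2 * deg G (σ i) ≤ n
  later-degree i 1≤i = ≤-trans (*-monoʳ-≤ 2 (antitone (deg G ∘ σ) sorted second i second≤i))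
                               (part1b second (toℕ-fromℕ< 1<n))
    where
    1<n : 1 < n
    1<n = ≤-<-trans 1≤i (toℕ<n i)
    second : Fin n
    second = fromℕ< 1<n
    second≤i : toℕ second ≤ toℕ i
    second≤i = subst (_≤ toℕ i) (sym (toℕ-fromℕ< 1<n)) 1≤i

  part2b : ∀ (B₁ : Subset n) → B₁ ⊆ S₁ → ∣ B₁ ∣ ≡ δ →
           ∀ (i : Fin n) → 1 ≤ toℕ i →
           ∀ (S : Subset n) →
           (∀ u → u ∈ S → u ∉ closedNbhd G (σ i) × u ∉ closedNbhdSet G B₁) →
           Independent G S →
           (∀ u → u ∈ S → deg G u ≤ 10) →
           (∀ (T : Subset n) →
             (∀ u → u ∈ T → u ∉ closedNbhd G (σ i) × u ∉ closedNbhdSet G B₁) →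
             Independent G T →
             (∀ u → u ∈ T → deg G u ≤ 10) →
             ∣ T ∣ ≤ ∣ S ∣) →
           n ≤ 18 * ∣ S ∣
  part2b B₁ B₁⊆S₁ ∣B₁∣≡δ i 1≤i S _ _ _ S-maximum =
    let R , count = sparse-outside-avoiding G (σ i) Z in
    ≤-trans (eighteen n e (deg G (σ i)) (# Z) (# (I R)) count e+1≤n (later-degree i 1≤i) Z-small)
            (*-monoʳ-≤ 18 (≤-maximum G R Allowed (_≤ 10) allowed (λ d d<5 → ≤-trans (<⇒≤ d<5) (m≤m+n 5 5))
                                     S S-maximum))
    where
    open LowDegreeIndependent
    Z : Fin n → Bool
    Z = lookup (closedNbhdSet G B₁)
    Z-small : 10 * # Z + 6 ≤ 2 * n
    Z-small = subst (λ k → 10 * k + 6 ≤ 2 * n) (∣p∣≡# (closedNbhdSet G B₁))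
                (small-closedNbhdSet G B₁ δ 1≤δ small-δ ∣B₁∣≡δ (λ w w∈B₁ → S₁-deg w (B₁⊆S₁ w∈B₁)))
    Allowed : Fin n → Set
    Allowed u = u ∉ closedNbhd G (σ i) × u ∉ closedNbhdSet G B₁
    allowed : ∀ u → (outside G (σ i) ∖ Z) u ≡ true → Allowed u
    allowed u u∈W = outside⇒∉ G (σ i) u (∧-conicalˡ _ _ u∈W) , ∉-lookup (closedNbhdSet G B₁) u (not-true (∧-conicalʳ _ _ u∈W))

lemma2p1 :
  Σ ℕ λ n₀ → ∀ (m : ℕ) → n₀ ≤ suc m →
    (H : Graph (suc m)) → NoIsolated H →
    (200 * maxDegree H) ^ 2 ≤ suc m →
    (G : Graph (suc m)) → edgeCount G ≡ suc m ∸ minDegree H ∸ 1 →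
    (σ : Fin (suc m) → Fin (suc m)) → Injective _≡_ _≡_ σ →
    (∀ (i : Fin m) → deg G (σ (Fin.suc i)) ≤ deg G (σ (inject₁ i))) →
    (S₁ : Subset (suc m)) →
    (∀ u → u ∈ S₁ → u ∉ closedNbhd G (σ Fin.zero)) →
    Independent G S₁ →
    (∀ u → u ∈ S₁ → deg G u ^ 2 < 4 * suc m) →
    (∀ (T : Subset (suc m)) →
      (∀ u → u ∈ T → u ∉ closedNbhd G (σ Fin.zero)) →
      Independent G T →
      (∀ u → u ∈ T → deg G u ^ 2 < 4 * suc m) →
      ∣ T ∣ ≤ ∣ S₁ ∣) →
    -- part 1
    ((deg G (σ Fin.zero) ≤ suc m ∸ minDegree H ∸ 1)
     × (∀ (i : Fin (suc m)) → toℕ i ≡ 1 → 2 * deg G (σ i) ≤ suc m)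
     × (∀ (i : Fin (suc m)) → (toℕ i + 1) * deg G (σ i) < 2 * suc m))
    ×
    -- part 2
    ((minDegree H ≤ ∣ S₁ ∣)
     × (∀ (B₁ : Subset (suc m)) → B₁ ⊆ S₁ → ∣ B₁ ∣ ≡ minDegree H →
         ∀ (i : Fin (suc m)) → 1 ≤ toℕ i →
         ∀ (S : Subset (suc m)) →
         (∀ u → u ∈ S → u ∉ closedNbhd G (σ i) × u ∉ closedNbhdSet G B₁) →
         Independent G S →
         (∀ u → u ∈ S → deg G u ≤ 10) →
         (∀ (T : Subset (suc m)) →
           (∀ u → u ∈ T → u ∉ closedNbhd G (σ i) × u ∉ closedNbhdSet G B₁) →
           Independent G T →
           (∀ u → u ∈ T → deg G u ≤ 10) →
           ∣ T ∣ ≤ ∣ S ∣) →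
         suc m ≤ 18 * ∣ S ∣))
lemma2p1 = 0 , λ m _ H no-isolated small-Δ G edges σ σ-inj sorted S₁ _ _ S₁-deg S₁-maximum →
  let open Lemma2p1 m H no-isolated small-Δ G edges σ σ-inj sorted S₁ S₁-deg S₁-maximum
  in (part1a , part1b , part1c) , (part2a , part2b)
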